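{- Let $p$ be a prime such that $p+2$ is also prime, and let $k=2p$ or $k=2p+1$. Then the permutation $\sigma$ of $[k]$ given by $\sigma(2p)=2$, $\sigma(2)=2p$, $\sigma(p+2)=p$, $\sigma(p)=p+2$, and $\sigma(i)=i$ for all other $i\in[k]$, is weakly consecutive.
   Context: $[k]=\{1,\dots,k\}$. A permutation $\sigma:[k]\to[k]$ is weakly consecutive if for all $i,j\in[k]$ and all integers $m$, whenever $m\mid\sigma(i)$ and $m\mid(i-j)$, also $m\mid\sigma(j)$. -}

module Defs where

open import Data.Nat using (ℕ; _+_; _*_; _≤_; _≟_)
open import Data.Integer using (ℤ; +_; _-_)
open import Data.Integer.Divisibility using (_∣_)
open import Data.Product using (_×_; ∃-syntax)
open import Relation.Nullary.Decidable using (does)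
open import Data.Bool using (if_then_else_)
open import Relation.Binary.PropositionalEquality using (_≡_)

InRange : ℕ → ℕ → Set
InRange k i = 1 ≤ i × i ≤ k

IsPermutation : ℕ → (ℕ → ℕ) → Set
IsPermutation k σ =
  (∀ i → InRange k i → InRange k (σ i)) ×
  (∀ i j → InRange k i → InRange k j → σ i ≡ σ j → i ≡ j) ×
  (∀ j → InRange k j → ∃[ i ] (InRange k i × σ i ≡ j))

WeaklyConsecutive : ℕ → (ℕ → ℕ) → Set
WeaklyConsecutive k σ =
  ∀ i j → InRange k i → InRange k j → (m : ℤ) →
  m ∣ (+ σ i) → m ∣ ((+ i) - (+ j)) → m ∣ (+ σ j)

sigma : ℕ → ℕ → ℕ
sigma p i =
  if does (i ≟ 2 * p) then 2 else
  if does (i ≟ 2) then 2 * p else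
  if does (i ≟ p + 2) then p else
  if does (i ≟ p) then p + 2 else i

-- For each d ≥ 1, weak consecutiveness asks that the set of x ∈ [k] with d ∣ σ x
-- be a union of residue classes mod d (m = 0 is vacuous, as σ x ≥ 1); here it is
-- a single class. σ is the involution exchanging 2 ↔ 2p and p ↔ p + 2, and twin
-- primality forces p ≥ 3, so these four points are distinct. If d ∉ {p, 2p, p + 2},
-- primality of p and p + 2 gives d ∣ 2p ⇔ d ∣ 2 and d ∣ p ⇔ d ∣ p + 2 ⇔ d = 1, so σ
-- preserves divisibility by d and the class is 0 mod d. For the three exceptional
-- moduli the sets are {2, p + 2}, {2} and {p}, which, because k < 2p + 2, are
-- exactly the classes of 2 mod p, of 2 mod 2p and of p mod p + 2 inside [k].
module Submission where

open import Defs
open import Data.Bool using (if_then_else_)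
open import Data.Nat
open import Data.Nat.Properties
open import Data.Nat.Divisibility
open import Data.Nat.DivMod
open import Data.Nat.GCD using (gcd[m,n]∣m; gcd[m,n]∣n)
open import Data.Nat.Coprimality using (gcd≡1⇒coprime; coprime-divisor)
open import Data.Nat.Primality
open import Data.Nat.Tactic.RingSolver using (solve)
import Data.Integer as ℤ
import Data.Integer.Properties as ℤ
open import Data.List using ([]; _∷_)
open import Data.Product using (_×_; _,_; proj₁; proj₂; ∃-syntax)
open import Data.Sum using (_⊎_; inj₁; inj₂; [_,_])
open import Function.Bundles using (_⇔_; mk⇔; Equivalence)
open import Relation.Nullary using (Dec; does; yes; no; contradiction)
open import Relation.Binary.PropositionalEquality
  using (_≡_; _≢_; refl; sym; trans; cong; subst; module ≡-Reasoning)

open Equivalence using (to; from)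

%≡%-∣∸ : ∀ {d i j} .{{_ : NonZero d}} → i ≤ j → d ∣ j ∸ i → i % d ≡ j % d
%≡%-∣∸ {d} {i} {j} i≤j d∣j∸i = begin
  i % d             ≡⟨ %-remove-+ʳ i d∣j∸i ⟨
  (i + (j ∸ i)) % d ≡⟨ cong (_% d) (m+[n∸m]≡n i≤j) ⟩
  j % d             ∎
  where open ≡-Reasoning

∣[+m]-[+n]∣≡n∸m : ∀ {m n} → m ≤ n → ℤ.∣ ℤ.+ m ℤ.- ℤ.+ n ∣ ≡ n ∸ m
∣[+m]-[+n]∣≡n∸m {m} {n} m≤n = trans (cong ℤ.∣_∣ (ℤ.[+m]-[+n]≡m⊖n m n)) (ℤ.∣⊖∣-≤ m≤n)

%≡%-∣[+i]-[+j]∣ : ∀ {d} .{{_ : NonZero d}} i j → d ∣ ℤ.∣ ℤ.+ i ℤ.- ℤ.+ j ∣ → i % d ≡ j % d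
%≡%-∣[+i]-[+j]∣ {d} i j d∣i-j with ≤-total i j
... | inj₁ i≤j = %≡%-∣∸ i≤j (subst (d ∣_) (∣[+m]-[+n]∣≡n∸m i≤j) d∣i-j)
... | inj₂ j≤i = sym (%≡%-∣∸ j≤i (subst (d ∣_) ∣i-j∣≡i∸j d∣i-j))
  where
  ∣i-j∣≡i∸j : ℤ.∣ ℤ.+ i ℤ.- ℤ.+ j ∣ ≡ i ∸ j
  ∣i-j∣≡i∸j = trans (ℤ.∣i-j∣≡∣j-i∣ (ℤ.+ i) (ℤ.+ j)) (∣[+m]-[+n]∣≡n∸m j≤i)

quotient< : ∀ {x r q d} n → x ≡ r + q * d → x < r + n * d → q < n
quotient< {r = r} {q} {d} n refl x< = *-cancelʳ-< d q n (+-cancelˡ-< r _ _ x<)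

residueWindow : ∀ {x r d} .{{_ : NonZero d}} n → x % d ≡ r → x < r + n * d →
  ∃[ q ] q < n × x ≡ r + q * d
residueWindow {x} {r} {d} n x%d≡r x< = x / d , quotient< n x≡r+qd x< , x≡r+qd
  where
  x≡r+qd : x ≡ r + (x / d) * d
  x≡r+qd = trans (m≡m%n+[m/n]*n x d) (cong (_+ (x / d) * d) x%d≡r)

PreimageIsResidueClass : ℕ → (ℕ → ℕ) → (d : ℕ) → .{{NonZero d}} → Set
PreimageIsResidueClass k σ d = ∃[ r ] (∀ x → InRange k x → d ∣ σ x ⇔ x % d ≡ r)

weaklyConsecutive-fromResidueClasses : ∀ {k σ} → (∀ i → InRange k i → InRange k (σ i)) →
  (∀ d .{{_ : NonZero d}} → PreimageIsResidueClass k σ d) → WeaklyConsecutive k σ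
weaklyConsecutive-fromResidueClasses {k} {σ} σ-maps residue i j i∈ j∈ m = transfer ℤ.∣ m ∣
  where
  transfer : ∀ d → d ∣ σ i → d ∣ ℤ.∣ ℤ.+ i ℤ.- ℤ.+ j ∣ → d ∣ σ j
  transfer zero 0∣σi _ = contradiction (0∣⇒≡0 0∣σi) (>⇒≢ (proj₁ (σ-maps i i∈)))
  transfer d@(suc _) d∣σi d∣i-j with residue d
  ... | r , preimage = from (preimage j j∈)
    (trans (sym (%≡%-∣[+i]-[+j]∣ i j d∣i-j)) (to (preimage i i∈) d∣σi))

∣p*m⇒∣m⊎p∣ : ∀ {p d} m → Prime p → d ∣ p * m → d ∣ m ⊎ p ∣ d
∣p*m⇒∣m⊎p∣ {p} {d} m p-prime d∣pm with prime⇒irreducible p-prime (gcd[m,n]∣n d p)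
... | inj₁ gcd≡1 = inj₁ (coprime-divisor (gcd≡1⇒coprime gcd≡1) d∣pm)
... | inj₂ gcd≡p = inj₂ (subst (_∣ d) gcd≡p (gcd[m,n]∣m d p))

∣2*p⇒∣2⊎≡p⊎≡2*p : ∀ {p d} → Prime p → d ∣ 2 * p → d ∣ 2 ⊎ d ≡ p ⊎ d ≡ 2 * p
∣2*p⇒∣2⊎≡p⊎≡2*p {p} {d} p-prime d∣2p with ∣p*m⇒∣m⊎p∣ 2 p-prime (subst (d ∣_) (*-comm 2 p) d∣2p)
... | inj₁ d∣2 = inj₁ d∣2
... | inj₂ (divides c refl) with irreducible[2] {c} (*-cancelʳ-∣ p {{prime⇒nonZero p-prime}} d∣2p)
...   | inj₁ refl = inj₂ (inj₁ (+-identityʳ p))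
...   | inj₂ refl = inj₂ (inj₂ refl)

twinPrime⇒2<p : ∀ {p} → Prime p → Prime (p + 2) → 2 < p
twinPrime⇒2<p {0} p-prime _ = contradiction p-prime ¬prime[0]
twinPrime⇒2<p {1} p-prime _ = contradiction p-prime ¬prime[1]
twinPrime⇒2<p {2} _ 4-prime = contradiction 4-prime (composite⇒¬prime composite[4])
twinPrime⇒2<p {suc (suc (suc _))} _ _ = s≤s (s≤s (s≤s z≤n))

data SigmaView (p x y : ℕ) : Set where
  at-2p  : x ≡ 2 * p → y ≡ 2 → SigmaView p x y
  at-2   : x ≡ 2 → y ≡ 2 * p → SigmaView p x y
  at-p+2 : x ≡ p + 2 → y ≡ p → SigmaView p x y
  at-p   : x ≡ p → y ≡ p + 2 → SigmaView p x y
  fixed  : x ≢ 2 * p → x ≢ 2 → x ≢ p + 2 → x ≢ p → y ≡ x → SigmaView p x y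

sigmaView : ∀ p x → SigmaView p x (sigma p x)
sigmaView p x = cases (x ≟ 2 * p) (x ≟ 2) (x ≟ p + 2) (x ≟ p)
  where
  -- The index is sigma p x unfolded, so that each clause computes it.
  cases : (a : Dec (x ≡ 2 * p)) (b : Dec (x ≡ 2)) (c : Dec (x ≡ p + 2)) (d : Dec (x ≡ p)) →
    SigmaView p x (if does a then 2 else if does b then 2 * p else
                   if does c then p else if does d then p + 2 else x)
  cases (yes x≡2p) _ _ _ = at-2p x≡2p refl
  cases (no _) (yes x≡2) _ _ = at-2 x≡2 refl
  cases (no _) (no _) (yes x≡p+2) _ = at-p+2 x≡p+2 refl
  cases (no _) (no _) (no _) (yes x≡p) = at-p x≡p refl
  cases (no x≢2p) (no x≢2) (no x≢p+2) (no x≢p) = fixed x≢2p x≢2 x≢p+2 x≢p refl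

module SigmaProperties {p : ℕ} (2<p : 2 < p) where

  p<p+2 : p < p + 2
  p<p+2 = m<m+n p z<s

  p+2<2p : p + 2 < 2 * p
  p+2<2p = +-monoʳ-< p (subst (2 <_) (sym (+-identityʳ p)) 2<p)

  2<p+2 : 2 < p + 2
  2<p+2 = <-trans 2<p p<p+2

  p<2p : p < 2 * p
  p<2p = <-trans p<p+2 p+2<2p

  2<2p : 2 < 2 * p
  2<2p = <-trans 2<p p<2p

  sigma-2p : sigma p (2 * p) ≡ 2
  sigma-2p with sigmaView p (2 * p)
  ... | at-2p _ σ≡ = σ≡
  ... | at-2 2p≡2 _ = contradiction 2p≡2 (>⇒≢ 2<2p)
  ... | at-p+2 2p≡p+2 _ = contradiction 2p≡p+2 (>⇒≢ p+2<2p)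
  ... | at-p 2p≡p _ = contradiction 2p≡p (>⇒≢ p<2p)
  ... | fixed 2p≢2p _ _ _ _ = contradiction refl 2p≢2p

  sigma-2 : sigma p 2 ≡ 2 * p
  sigma-2 with sigmaView p 2
  ... | at-2p 2≡2p _ = contradiction 2≡2p (<⇒≢ 2<2p)
  ... | at-2 _ σ≡ = σ≡
  ... | at-p+2 2≡p+2 _ = contradiction 2≡p+2 (<⇒≢ 2<p+2)
  ... | at-p 2≡p _ = contradiction 2≡p (<⇒≢ 2<p)
  ... | fixed _ 2≢2 _ _ _ = contradiction refl 2≢2

  sigma-p+2 : sigma p (p + 2) ≡ p
  sigma-p+2 with sigmaView p (p + 2)
  ... | at-2p p+2≡2p _ = contradiction p+2≡2p (<⇒≢ p+2<2p)
  ... | at-2 p+2≡2 _ = contradiction p+2≡2 (>⇒≢ 2<p+2)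
  ... | at-p+2 _ σ≡ = σ≡
  ... | at-p p+2≡p _ = contradiction p+2≡p (>⇒≢ p<p+2)
  ... | fixed _ _ p+2≢p+2 _ _ = contradiction refl p+2≢p+2

  sigma-p : sigma p p ≡ p + 2
  sigma-p with sigmaView p p
  ... | at-2p p≡2p _ = contradiction p≡2p (<⇒≢ p<2p)
  ... | at-2 p≡2 _ = contradiction p≡2 (>⇒≢ 2<p)
  ... | at-p+2 p≡p+2 _ = contradiction p≡p+2 (<⇒≢ p<p+2)
  ... | at-p _ σ≡ = σ≡
  ... | fixed _ _ _ p≢p _ = contradiction refl p≢p

  sigma-involutive : ∀ x → sigma p (sigma p x) ≡ x
  sigma-involutive x with sigmaView p x
  ... | at-2p refl σ≡ = trans (cong (sigma p) σ≡) sigma-2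
  ... | at-2 refl σ≡ = trans (cong (sigma p) σ≡) sigma-2p
  ... | at-p+2 refl σ≡ = trans (cong (sigma p) σ≡) sigma-p
  ... | at-p refl σ≡ = trans (cong (sigma p) σ≡) sigma-p+2
  ... | fixed _ _ _ _ σ≡ = trans (cong (sigma p) σ≡) σ≡

  sigma-maps-range : ∀ {k} → 2 * p ≤ k → ∀ x → InRange k x → InRange k (sigma p x)
  sigma-maps-range {k} 2p≤k x x∈ with sigmaView p x
  ... | at-2p _ σ≡ = subst (InRange k) (sym σ≡) (s≤s z≤n , ≤-trans (<⇒≤ 2<2p) 2p≤k)
  ... | at-2 _ σ≡ = subst (InRange k) (sym σ≡) (≤-trans (s≤s z≤n) (<⇒≤ 2<2p) , 2p≤k)
  ... | at-p+2 _ σ≡ = subst (InRange k) (sym σ≡) (≤-trans (s≤s z≤n) (<⇒≤ 2<p) , ≤-trans (<⇒≤ p<2p) 2p≤k)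
  ... | at-p _ σ≡ = subst (InRange k) (sym σ≡) (≤-trans (s≤s z≤n) (<⇒≤ 2<p+2) , ≤-trans (<⇒≤ p+2<2p) 2p≤k)
  ... | fixed _ _ _ _ σ≡ = subst (InRange k) (sym σ≡) x∈

  sigma-isPermutation : ∀ {k} → 2 * p ≤ k → IsPermutation k (sigma p)
  sigma-isPermutation 2p≤k =
    sigma-maps-range 2p≤k ,
    (λ i j _ _ σi≡σj → trans (sym (sigma-involutive i)) (trans (cong (sigma p) σi≡σj) (sigma-involutive j))) ,
    λ j j∈ → sigma p j , sigma-maps-range 2p≤k j j∈ , sigma-involutive j

module TwinPrimeSwap {p k : ℕ} (p-prime : Prime p) (p+2-prime : Prime (p + 2))
                     (k≤2p+1 : k ≤ 2 * p + 1) where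

  2<p : 2 < p
  2<p = twinPrime⇒2<p p-prime p+2-prime

  open SigmaProperties 2<p public

  instance
    p≢0 : NonZero p
    p≢0 = prime⇒nonZero p-prime
    p+2≢0 : NonZero (p + 2)
    p+2≢0 = prime⇒nonZero p+2-prime
    2p≢0 : NonZero (2 * p)
    2p≢0 = >-nonZero (<-trans z<s 2<2p)

  σ : ℕ → ℕ
  σ = sigma p

  inRange⇒< : ∀ {x m} → InRange k x → 2 + 2 * p ≤ m → x < m
  inRange⇒< {x} x∈ 2+2p≤m = <-≤-trans (s≤s x≤1+2p) 2+2p≤m
    where
    x≤1+2p : x ≤ 1 + 2 * p
    x≤1+2p = ≤-trans (proj₂ x∈) (≤-trans k≤2p+1 (≤-reflexive (+-comm (2 * p) 1)))

  inRange⇒≢0 : ∀ {x} → InRange k x → x ≢ 0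
  inRange⇒≢0 x∈ = >⇒≢ (proj₁ x∈)

  p-preimage : PreimageIsResidueClass k σ p
  p-preimage = 2 , λ x x∈ → mk⇔ (divides⇒residue x∈ (sigmaView p x)) (residue⇒divides x∈)
    where
    2+2p≤3p : 2 + 2 * p ≤ 0 + 3 * p
    2+2p≤3p = +-monoˡ-≤ (2 * p) (<⇒≤ 2<p)
    2+1*p≡p+2 : 2 + 1 * p ≡ p + 2
    2+1*p≡p+2 = solve (p ∷ [])
    divides⇒residue : ∀ {x} → InRange k x → SigmaView p x (σ x) → p ∣ σ x → x % p ≡ 2
    divides⇒residue _ (at-2p _ σx≡2) p∣σx = contradiction (subst (p ∣_) σx≡2 p∣σx) (>⇒∤ 2<p)
    divides⇒residue _ (at-2 refl _) _ = m<n⇒m%n≡m 2<p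
    divides⇒residue _ (at-p+2 refl _) _ = trans (%-remove-+ˡ {p} 2 ∣-refl) (m<n⇒m%n≡m 2<p)
    divides⇒residue _ (at-p _ σx≡p+2) p∣σx =
      contradiction (∣m+n∣m⇒∣n (subst (p ∣_) σx≡p+2 p∣σx) ∣-refl) (>⇒∤ 2<p)
    divides⇒residue {x} x∈ (fixed x≢2p _ _ x≢p σx≡x) p∣σx
      with residueWindow 3 (n∣m⇒m%n≡0 x p (subst (p ∣_) σx≡x p∣σx)) (inRange⇒< x∈ 2+2p≤3p)
    ... | 0 , _ , x≡0 = contradiction x≡0 (inRange⇒≢0 x∈)
    ... | 1 , _ , x≡p = contradiction (trans x≡p (+-identityʳ p)) x≢p
    ... | 2 , _ , x≡2p = contradiction x≡2p x≢2p
    ... | suc (suc (suc _)) , s≤s (s≤s (s≤s ())) , _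
    residue⇒divides : ∀ {x} → InRange k x → x % p ≡ 2 → p ∣ σ x
    residue⇒divides x∈ x%p≡2 with residueWindow 2 x%p≡2 (inRange⇒< x∈ ≤-refl)
    ... | 0 , _ , refl = subst (p ∣_) (sym sigma-2) (n∣m*n 2)
    ... | suc (suc _) , s≤s (s≤s ()) , _
    ... | 1 , _ , refl = subst (p ∣_) (sym (trans (cong σ 2+1*p≡p+2) sigma-p+2)) ∣-refl

  2p-preimage : PreimageIsResidueClass k σ (2 * p)
  2p-preimage = 2 , λ x x∈ → mk⇔ (divides⇒residue x∈ (sigmaView p x)) (residue⇒divides x∈)
    where
    2+2p≤2*2p : 2 + 2 * p ≤ 0 + 2 * (2 * p)
    2+2p≤2*2p = ≤-trans (+-monoˡ-≤ (2 * p) (<⇒≤ 2<2p)) (≤-reflexive 2p+2p≡2*2p)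
      where
      2p+2p≡2*2p : 2 * p + 2 * p ≡ 2 * (2 * p)
      2p+2p≡2*2p = solve (p ∷ [])
    2+2p≡2+1*2p : 2 + 2 * p ≡ 2 + 1 * (2 * p)
    2+2p≡2+1*2p = solve (p ∷ [])
    divides⇒residue : ∀ {x} → InRange k x → SigmaView p x (σ x) → 2 * p ∣ σ x → x % (2 * p) ≡ 2
    divides⇒residue _ (at-2p _ σx≡2) 2p∣σx = contradiction (subst (2 * p ∣_) σx≡2 2p∣σx) (>⇒∤ 2<2p)
    divides⇒residue _ (at-2 refl _) _ = m<n⇒m%n≡m 2<2p
    divides⇒residue _ (at-p+2 _ σx≡p) 2p∣σx = contradiction (subst (2 * p ∣_) σx≡p 2p∣σx) (>⇒∤ p<2p)
    divides⇒residue _ (at-p _ σx≡p+2) 2p∣σx = contradiction (subst (2 * p ∣_) σx≡p+2 2p∣σx) (>⇒∤ p+2<2p)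
    divides⇒residue {x} x∈ (fixed x≢2p _ _ _ σx≡x) 2p∣σx
      with residueWindow 2 (n∣m⇒m%n≡0 x (2 * p) (subst (2 * p ∣_) σx≡x 2p∣σx)) (inRange⇒< x∈ 2+2p≤2*2p)
    ... | 0 , _ , x≡0 = contradiction x≡0 (inRange⇒≢0 x∈)
    ... | 1 , _ , x≡2p = contradiction (trans x≡2p (+-identityʳ (2 * p))) x≢2p
    ... | suc (suc _) , s≤s (s≤s ()) , _
    residue⇒divides : ∀ {x} → InRange k x → x % (2 * p) ≡ 2 → 2 * p ∣ σ x
    residue⇒divides x∈ x%2p≡2 with residueWindow 1 x%2p≡2 (inRange⇒< x∈ (≤-reflexive 2+2p≡2+1*2p))
    ... | 0 , _ , refl = subst (2 * p ∣_) (sym sigma-2) ∣-refl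
    ... | suc _ , s≤s () , _

  p+2-preimage : PreimageIsResidueClass k σ (p + 2)
  p+2-preimage = p , λ x x∈ → mk⇔ (divides⇒residue x∈ (sigmaView p x)) (residue⇒divides x∈)
    where
    2+2p≤2*[p+2] : 2 + 2 * p ≤ 0 + 2 * (p + 2)
    2+2p≤2*[p+2] = ≤-trans (m≤m+n (2 + 2 * p) 2) (≤-reflexive (solve (p ∷ [])))
    2+2p≡p+1*[p+2] : 2 + 2 * p ≡ p + 1 * (p + 2)
    2+2p≡p+1*[p+2] = solve (p ∷ [])
    divides⇒residue : ∀ {x} → InRange k x → SigmaView p x (σ x) → p + 2 ∣ σ x → x % (p + 2) ≡ p
    divides⇒residue _ (at-2p _ σx≡2) p+2∣σx = contradiction (subst (p + 2 ∣_) σx≡2 p+2∣σx) (>⇒∤ 2<p+2)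
    divides⇒residue _ (at-2 _ σx≡2p) p+2∣σx with euclidsLemma 2 p p+2-prime (subst (p + 2 ∣_) σx≡2p p+2∣σx)
    ... | inj₁ p+2∣2 = contradiction p+2∣2 (>⇒∤ 2<p+2)
    ... | inj₂ p+2∣p = contradiction p+2∣p (>⇒∤ p<p+2)
    divides⇒residue _ (at-p+2 _ σx≡p) p+2∣σx = contradiction (subst (p + 2 ∣_) σx≡p p+2∣σx) (>⇒∤ p<p+2)
    divides⇒residue _ (at-p refl _) _ = m<n⇒m%n≡m p<p+2
    divides⇒residue {x} x∈ (fixed _ _ x≢p+2 _ σx≡x) p+2∣σx
      with residueWindow 2 (n∣m⇒m%n≡0 x (p + 2) (subst (p + 2 ∣_) σx≡x p+2∣σx)) (inRange⇒< x∈ 2+2p≤2*[p+2])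
    ... | 0 , _ , x≡0 = contradiction x≡0 (inRange⇒≢0 x∈)
    ... | 1 , _ , x≡p+2 = contradiction (trans x≡p+2 (+-identityʳ (p + 2))) x≢p+2
    ... | suc (suc _) , s≤s (s≤s ()) , _
    residue⇒divides : ∀ {x} → InRange k x → x % (p + 2) ≡ p → p + 2 ∣ σ x
    residue⇒divides x∈ x%[p+2]≡p with residueWindow 1 x%[p+2]≡p (inRange⇒< x∈ (≤-reflexive 2+2p≡p+1*[p+2]))
    ... | 0 , _ , refl = subst (p + 2 ∣_) (sym (trans (cong σ (+-identityʳ p)) sigma-p)) ∣-refl
    ... | suc _ , s≤s () , _

  generic-preimage : ∀ d .{{_ : NonZero d}} → d ≢ p → d ≢ 2 * p → d ≢ p + 2 →
    PreimageIsResidueClass k σ d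
  generic-preimage d d≢p d≢2p d≢p+2 =
    0 , λ x _ → mk⇔ (λ d∣σx → n∣m⇒m%n≡0 x d (subst (d ∣_) (sigma-involutive x) (σ-pres-∣ (σ x) d∣σx)))
                    (λ x%d≡0 → σ-pres-∣ x (m%n≡0⇒n∣m x d x%d≡0))
    where
    ∣prime⇒∣all : ∀ {q} → Prime q → d ≢ q → d ∣ q → ∀ n → d ∣ n
    ∣prime⇒∣all q-prime d≢q d∣q n with prime⇒irreducible q-prime d∣q
    ... | inj₁ refl = 1∣ n
    ... | inj₂ d≡q = contradiction d≡q d≢q
    ∣2p⇒∣2 : d ∣ 2 * p → d ∣ 2
    ∣2p⇒∣2 d∣2p with ∣2*p⇒∣2⊎≡p⊎≡2*p p-prime d∣2p
    ... | inj₁ d∣2 = d∣2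
    ... | inj₂ (inj₁ d≡p) = contradiction d≡p d≢p
    ... | inj₂ (inj₂ d≡2p) = contradiction d≡2p d≢2p
    σ-pres-∣ : ∀ x → d ∣ x → d ∣ σ x
    σ-pres-∣ x d∣x with sigmaView p x
    ... | at-2p refl σx≡2 = subst (d ∣_) (sym σx≡2) (∣2p⇒∣2 d∣x)
    ... | at-2 refl σx≡2p = subst (d ∣_) (sym σx≡2p) (∣m⇒∣m*n p d∣x)
    ... | at-p+2 refl _ = ∣prime⇒∣all p+2-prime d≢p+2 d∣x (σ x)
    ... | at-p refl _ = ∣prime⇒∣all p-prime d≢p d∣x (σ x)
    ... | fixed _ _ _ _ σx≡x = subst (d ∣_) (sym σx≡x) d∣x

  preimageIsResidueClass : ∀ d .{{_ : NonZero d}} → PreimageIsResidueClass k σ d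
  preimageIsResidueClass d with d ≟ p | d ≟ 2 * p | d ≟ p + 2
  ... | yes refl | _ | _ = p-preimage
  ... | no _ | yes refl | _ = 2p-preimage
  ... | no _ | no _ | yes refl = p+2-preimage
  ... | no d≢p | no d≢2p | no d≢p+2 = generic-preimage d d≢p d≢2p d≢p+2

mainTheorem8 : (p k : ℕ) → Prime p → Prime (p + 2) →
    (k ≡ 2 * p ⊎ k ≡ 2 * p + 1) →
    IsPermutation k (sigma p) × WeaklyConsecutive k (sigma p)
mainTheorem8 p k p-prime p+2-prime k≡2p⊎2p+1 =
  sigma-isPermutation 2p≤k ,
  weaklyConsecutive-fromResidueClasses (sigma-maps-range 2p≤k) preimageIsResidueClass
  where
  2p≤k : 2 * p ≤ k
  2p≤k = [ (λ { refl → ≤-refl }) , (λ { refl → m≤m+n (2 * p) 1 }) ] k≡2p⊎2p+1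
  k≤2p+1 : k ≤ 2 * p + 1
  k≤2p+1 = [ (λ { refl → m≤m+n (2 * p) 1 }) , (λ { refl → ≤-refl }) ] k≡2p⊎2p+1
  open TwinPrimeSwap p-prime p+2-prime k≤2p+1
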